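{- For $n\geq2$ and $i\in\{1,2,3\}$, the quotient $G_n/N_{i,n}$ is cyclic, and (1) $|G_n/N_{i,n}|\leq 2|G_{n-1}/N_{i,n-1}|$; (2) $|G_n/N_{3,n}|\geq|G_{n-1}/N_{2,n-1}|$; (3) $|G_n/N_{2,n}|\geq|G_{n-1}/N_{1,n-1}|$; (4) $|G_n/N_{1,n}|\geq 2|G_{n-1}/N_{3,n-1}|$.
   Context: $T$ is the infinite rooted binary tree of finite words over $\{1,2\}$, $T_n$ the words of length $\le n$, $W=\mathrm{Aut}(T)$, $W_n=\mathrm{Aut}(T_n)$, $\pi_n:W\to W_n$ restriction. For $u,v$, $(u,v)$ acts by $1w\mapsto1u(w)$, $2w\mapsto2v(w)$; $\sigma$ swaps the first letter; $(u,v)\sigma=(u,v)\circ\sigma$. $a_1,a_2,a_3\in W$ are defined by $a_1=(\mathrm{id},a_3)$, $a_2=(\mathrm{id},a_1)\sigma$, $a_3=(a_2,\mathrm{id})\sigma$; $G$ is the closed subgroup they generate, $G_n=\pi_n(G)$. For $i\in\{1,2,3\}$, $N_i$ is the normal closure in $G$ of the subgroup generated by $a_i$, and $N_{i,n}=\pi_n(N_i)$. -}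

module Defs where

open import Data.Bool using (Bool; true; false; _xor_)
open import Data.Nat using (ℕ; zero; suc)
open import Data.Integer using (ℤ; +_; -[1+_])
open import Data.Fin using (Fin)
open import Data.Vec using (Vec; lookup)
open import Data.List using (List; []; _∷_)
open import Data.Product using (Σ; _×_)
open import Relation.Binary.PropositionalEquality using (_≡_)

data Letter : Set where
  l1 l2 : Letter

flipL : Bool → Letter → Letter
flipL false x = x
flipL true l1 = l2
flipL true l2 = l1

-- W_n = Aut(T_n), in (canonical) portrait form:
--   node b u v  represents  (u , v) σ^b   (i.e. (u,v) ∘ σ^b),
-- for u v ∈ W_{n-1}.  Every automorphism of T_n has exactly one such
-- representation, so propositional equality is equality of automorphisms.
data Aut : ℕ → Set where
  leaf : Aut zero
  node : {n : ℕ} → Bool → Aut n → Aut n → Aut (suc n)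

-- The action on words (a word longer than n is acted on in its first n letters;
-- on T_n, i.e. words of length ≤ n, this is the automorphism itself).
act : {n : ℕ} → Aut n → List Letter → List Letter
act leaf w = w
act (node b u v) [] = []
act (node b u v) (x ∷ w) with flipL b x
... | l1 = l1 ∷ act u w
... | l2 = l2 ∷ act v w

idA : (n : ℕ) → Aut n
idA zero = leaf
idA (suc n) = node false (idA n) (idA n)

-- composition  g ∘ h  (first h, then g)
infixl 7 _∘A_
_∘A_ : {n : ℕ} → Aut n → Aut n → Aut n
leaf ∘A leaf = leaf
node false g1 g2 ∘A node c h1 h2 = node c (g1 ∘A h1) (g2 ∘A h2)
node true g1 g2 ∘A node c h1 h2 = node (true xor c) (g1 ∘A h2) (g2 ∘A h1)

invA : {n : ℕ} → Aut n → Aut n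
invA leaf = leaf
invA (node false u v) = node false (invA u) (invA v)
invA (node true u v) = node true (invA v) (invA u)

powℕ : {n : ℕ} → Aut n → ℕ → Aut n
powℕ {n} g zero = idA n
powℕ g (suc k) = g ∘A powℕ g k

powℤ : {n : ℕ} → Aut n → ℤ → Aut n
powℤ g (+ k) = powℕ g k
powℤ g -[1+ k ] = invA (powℕ g (suc k))

data Gen : Set where
  g1 g2 g3 : Gen

-- a i n = π_n(a_i), computed from
--   a_1 = (id , a_3),  a_2 = (id , a_1) σ,  a_3 = (a_2 , id) σ.
a : Gen → (n : ℕ) → Aut n
a _ zero = leaf
a g1 (suc n) = node false (idA n) (a g3 n)
a g2 (suc n) = node true (idA n) (a g1 n)
a g3 (suc n) = node true (a g2 n) (idA n)

-- G_n = π_n(G): the subgroup of W_n generated by π_n(a_1), π_n(a_2), π_n(a_3).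
data InG (n : ℕ) : Aut n → Set where
  gen : (i : Gen) → InG n (a i n)
  one : InG n (idA n)
  mul : {x y : Aut n} → InG n x → InG n y → InG n (x ∘A y)
  inv : {x : Aut n} → InG n x → InG n (invA x)

-- N_{i,n} = π_n(N_i): the normal closure of π_n(a_i) in G_n.
data InN (n : ℕ) (i : Gen) : Aut n → Set where
  base : InN n i (a i n)
  one  : InN n i (idA n)
  mul  : {x y : Aut n} → InN n i x → InN n i y → InN n i (x ∘A y)
  inv  : {x : Aut n} → InN n i x → InN n i (invA x)
  conj : {g x : Aut n} → InG n g → InN n i x → InN n i (g ∘A x ∘A invA g)

-- |G_n / N_{i,n}| = m : there is a complete, irredundant system of m
-- coset representatives of N_{i,n} in G_n.
QuotOrder : (n : ℕ) → Gen → ℕ → Set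
QuotOrder n i m =
  Σ (Vec (Aut n) m) λ r →
    ((p : Fin m) → InG n (lookup r p)) ×
    ((p q : Fin m) → InN n i (lookup r p ∘A invA (lookup r q)) → p ≡ q) ×
    ((g : Aut n) → InG n g → Σ (Fin m) λ p → InN n i (g ∘A invA (lookup r p)))

QuotCyclic : (n : ℕ) → Gen → Set
QuotCyclic n i =
  Σ (Aut n) λ g → InG n g ×
    ((h : Aut n) → InG n h → Σ ℤ λ k → InN n i (h ∘A invA (powℤ g k)))

-- G_n/N_{i,n} is cyclic of order M₁ n for i = 1 and M₂ n for i = 2, 3, where
-- M₁ (n+1) = 2 M₂ n and M₂ (n+1) = M₁ n; the four inequalities are then immediate.
--
-- Generators: a₂ generates G_n/N₁ and a₁ generates G_n/N₂ and G_n/N₃, because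
-- a₁a₂a₃ = 1 expresses the third generator as an inverse of the other two.
--
-- Upper bound: modulo the normal closure G′ of [a₁,a₂] the group G_n is abelian, and the maps
-- x ↦ (x,x) and x ↦ (id,x) carry G′_n into G′_{n+1}.  Since a₂² = (a₁,a₁) and a₁ = (id,a₃),
-- induction on n puts a₂^{M₁ n}, a₁^{M₂ n} and a₃^{M₁ n} in G′_n ⊆ N_{i,n}.
--
-- Lower bound: integer invariants φ₁, φ₂ and φ₃ = φ₂ − φ₁, defined by recursion on the portrait,
-- are additive on G_n modulo M₁ n, M₂ n, M₂ n; they vanish on a₁, a₂, a₃ respectively and are 1
-- on the chosen generator.  Additivity of φ₁ at level n+1 rests on the congruence
-- φ₃ v − φ₃ u ≡ b (mod M₂ n) for every (u,v)σᵇ ∈ G_{n+1}.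

module Submission where

open import Defs
open import Algebra.Bundles using (Group)
open import Algebra.Structures using (IsGroup)
import Algebra.Properties.Group as GroupProperties
open import Data.Bool using (Bool; true; false; not)
open import Data.Empty using (⊥-elim)
open import Data.Fin using (Fin; toℕ; fromℕ<)
open import Data.Fin.Properties using (toℕ-injective; toℕ<n; toℕ-fromℕ<)
open import Data.Integer as ℤ using (ℤ; +_; 0ℤ; 1ℤ; _+_; _-_; -_)
import Data.Integer.Properties as ℤ
open import Data.Integer.Divisibility.Signed as ℤ∣
  using (divides; ∣-trans; ∣m∣n⇒∣m+n; ∣m⇒∣-m; *-monoʳ-∣; ∣⇒∣ᵤ; ∣ᵤ⇒∣)
open import Data.Integer.Tactic.RingSolver using (solve-∀)
open import Data.Nat using (ℕ; zero; suc; pred; NonZero; z≤n; s≤s; _≤_; _<_; _*_; _∸_)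
import Data.Nat as ℕ using (_+_; >-nonZero)
import Data.Nat.Properties as ℕ
import Data.Nat.Divisibility as ℕ∣
open import Data.Nat.DivMod using (_%_; _/_; m≡m%n+[m/n]*n; m%n<n)
open import Data.Product using (Σ; _×_; _,_; proj₁; proj₂)
open import Data.Sum using (_⊎_; inj₁; inj₂)
open import Data.Vec using (Vec; tabulate; lookup)
open import Data.Vec.Properties using (lookup∘tabulate)
open import Function using (_∘_)
open import Level using (0ℓ)
open import Relation.Binary.Bundles using (Setoid)
import Relation.Binary.Reasoning.Setoid as SetoidReasoning
open import Relation.Binary.PropositionalEquality

∘A-identityˡ : ∀ {n} (x : Aut n) → idA n ∘A x ≡ x
∘A-identityˡ leaf = refl
∘A-identityˡ (node b u v) = cong₂ (node b) (∘A-identityˡ u) (∘A-identityˡ v)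

∘A-identityʳ : ∀ {n} (x : Aut n) → x ∘A idA n ≡ x
∘A-identityʳ leaf = refl
∘A-identityʳ (node false u v) = cong₂ (node false) (∘A-identityʳ u) (∘A-identityʳ v)
∘A-identityʳ (node true u v) = cong₂ (node true) (∘A-identityʳ u) (∘A-identityʳ v)

∘A-assoc : ∀ {n} (x y z : Aut n) → (x ∘A y) ∘A z ≡ x ∘A (y ∘A z)
∘A-assoc leaf leaf leaf = refl
∘A-assoc (node false x₁ x₂) (node false y₁ y₂) (node d z₁ z₂) =
  cong₂ (node d) (∘A-assoc x₁ y₁ z₁) (∘A-assoc x₂ y₂ z₂)
∘A-assoc (node false x₁ x₂) (node true y₁ y₂) (node d z₁ z₂) =
  cong₂ (node (not d)) (∘A-assoc x₁ y₁ z₂) (∘A-assoc x₂ y₂ z₁)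
∘A-assoc (node true x₁ x₂) (node false y₁ y₂) (node d z₁ z₂) =
  cong₂ (node (not d)) (∘A-assoc x₁ y₂ z₂) (∘A-assoc x₂ y₁ z₁)
∘A-assoc (node true x₁ x₂) (node true y₁ y₂) (node false z₁ z₂) =
  cong₂ (node false) (∘A-assoc x₁ y₂ z₁) (∘A-assoc x₂ y₁ z₂)
∘A-assoc (node true x₁ x₂) (node true y₁ y₂) (node true z₁ z₂) =
  cong₂ (node true) (∘A-assoc x₁ y₂ z₁) (∘A-assoc x₂ y₁ z₂)

invA-inverseˡ : ∀ {n} (x : Aut n) → invA x ∘A x ≡ idA n
invA-inverseˡ leaf = refl
invA-inverseˡ (node false u v) = cong₂ (node false) (invA-inverseˡ u) (invA-inverseˡ v)
invA-inverseˡ (node true u v) = cong₂ (node false) (invA-inverseˡ v) (invA-inverseˡ u)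

invA-inverseʳ : ∀ {n} (x : Aut n) → x ∘A invA x ≡ idA n
invA-inverseʳ leaf = refl
invA-inverseʳ (node false u v) = cong₂ (node false) (invA-inverseʳ u) (invA-inverseʳ v)
invA-inverseʳ (node true u v) = cong₂ (node false) (invA-inverseʳ u) (invA-inverseʳ v)

Aut-isGroup : ∀ n → IsGroup _≡_ (_∘A_ {n}) (idA n) invA
Aut-isGroup n = record
  { isMonoid = record
    { isSemigroup = record
      { isMagma = record { isEquivalence = isEquivalence ; ∙-cong = cong₂ _∘A_ }
      ; assoc = ∘A-assoc }
    ; identity = ∘A-identityˡ , ∘A-identityʳ }
  ; inverse = invA-inverseˡ , invA-inverseʳ
  ; ⁻¹-cong = cong invA
  }

Aut-group : ℕ → Group 0ℓ 0ℓ
Aut-group n = record { isGroup = Aut-isGroup n }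

module AutProperties {n : ℕ} = GroupProperties (Aut-group n)
open AutProperties using (⁻¹-involutive; ⁻¹-anti-homo-∙; ε⁻¹≈ε; inverseˡ-unique; inverseʳ-unique)

infix 4 _≡_[mod_]
record _≡_[mod_] (x y : ℤ) (m : ℕ) : Set where
  constructor congruent
  field m∣x-y : + m ℤ∣.∣ x - y
open _≡_[mod_]

module _ {m : ℕ} where

  mod-reflexive : ∀ {x y} → x ≡ y → x ≡ y [mod m ]
  mod-reflexive {x} refl = congruent (divides 0ℤ (trans (ℤ.+-inverseʳ x) (sym (ℤ.*-zeroˡ (+ m)))))

  mod-refl : ∀ {x} → x ≡ x [mod m ]
  mod-refl = mod-reflexive refl

  mod-sym : ∀ {x y} → x ≡ y [mod m ] → y ≡ x [mod m ]
  mod-sym {x} {y} (congruent m∣x-y) = congruent (subst (+ m ℤ∣.∣_) (negate x y) (∣m⇒∣-m m∣x-y))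
    where negate : ∀ x y → - (x - y) ≡ y - x
          negate = solve-∀

  mod-trans : ∀ {x y z} → x ≡ y [mod m ] → y ≡ z [mod m ] → x ≡ z [mod m ]
  mod-trans {x} {y} {z} (congruent m∣x-y) (congruent m∣y-z) =
    congruent (subst (+ m ℤ∣.∣_) (telescope x y z) (∣m∣n⇒∣m+n m∣x-y m∣y-z))
    where telescope : ∀ x y z → (x - y) + (y - z) ≡ x - z
          telescope = solve-∀

  mod-+-cong : ∀ {x y u v} → x ≡ y [mod m ] → u ≡ v [mod m ] → x + u ≡ y + v [mod m ]
  mod-+-cong {x} {y} {u} {v} (congruent m∣x-y) (congruent m∣u-v) =
    congruent (subst (+ m ℤ∣.∣_) (interchange x y u v) (∣m∣n⇒∣m+n m∣x-y m∣u-v))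
    where interchange : ∀ x y u v → (x - y) + (u - v) ≡ (x + u) - (y + v)
          interchange = solve-∀

  mod-+-congˡ : ∀ x {u v} → u ≡ v [mod m ] → x + u ≡ x + v [mod m ]
  mod-+-congˡ x = mod-+-cong (mod-refl {x})

  mod-+-congʳ : ∀ u {x y} → x ≡ y [mod m ] → x + u ≡ y + u [mod m ]
  mod-+-congʳ u x≡y = mod-+-cong x≡y (mod-refl {u})

  mod-neg-cong : ∀ {x y} → x ≡ y [mod m ] → - x ≡ - y [mod m ]
  mod-neg-cong {x} {y} (congruent m∣x-y) = congruent (subst (+ m ℤ∣.∣_) (negate x y) (∣m⇒∣-m m∣x-y))
    where negate : ∀ x y → - (x - y) ≡ - x - - y
          negate = solve-∀

  mod-−-cong : ∀ {x y u v} → x ≡ y [mod m ] → u ≡ v [mod m ] → x - u ≡ y - v [mod m ]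
  mod-−-cong x≡y u≡v = mod-+-cong x≡y (mod-neg-cong u≡v)

  mod-double : ∀ {x y} → x ≡ y [mod m ] → + 2 ℤ.* x ≡ + 2 ℤ.* y [mod 2 * m ]
  mod-double {x} {y} (congruent m∣x-y) =
    congruent (subst₂ ℤ∣._∣_ (sym (ℤ.pos-* 2 m)) (double x y) (*-monoʳ-∣ (+ 2) m∣x-y))
    where double : ∀ x y → + 2 ℤ.* (x - y) ≡ + 2 ℤ.* x - + 2 ℤ.* y
          double = solve-∀

  mod-weaken : ∀ {d x y} → d ℕ∣.∣ m → x ≡ y [mod m ] → x ≡ y [mod d ]
  mod-weaken d∣m (congruent m∣x-y) = congruent (∣-trans (∣ᵤ⇒∣ d∣m) m∣x-y)

mod-one : ∀ x y → x ≡ y [mod 1 ]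
mod-one x y = congruent (divides (x - y) (sym (ℤ.*-identityʳ (x - y))))

mod-setoid : ℕ → Setoid 0ℓ 0ℓ
mod-setoid m = record
  { Carrier = ℤ
  ; _≈_ = _≡_[mod m ]
  ; isEquivalence = record { refl = mod-refl ; sym = mod-sym ; trans = mod-trans }
  }

module ModReasoning (m : ℕ) = SetoidReasoning (mod-setoid m)

mod-injective : ∀ {m a b} → a < m → b < m → + a ≡ + b [mod m ] → a ≡ b
mod-injective {m} {a} {b} a<m b<m a≡b = ℤ.+-injective (ℤ.i-j≡0⇒i≡j (+ a) (+ b) (ℤ.∣i∣≡0⇒i≡0 ∣a-b∣≡0))
  where
  ∣a-b∣<m : ℤ.∣ + a - + b ∣ < m
  ∣a-b∣<m = subst (_< m) (cong ℤ.∣_∣ (sym (ℤ.m-n≡m⊖n a b)))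
              (ℕ.≤-<-trans (ℤ.∣m⊝n∣≤m⊔n a b) (ℕ.⊔-lub a<m b<m))
  ∣a-b∣≡0 : ℤ.∣ + a - + b ∣ ≡ 0
  ∣a-b∣≡0 with ℤ.∣ + a - + b ∣ | ∣a-b∣<m | ∣⇒∣ᵤ (m∣x-y a≡b)
  ... | zero  | _   | _ = refl
  ... | suc _ | d<m | m∣d = ⊥-elim (ℕ∣.>⇒∤ d<m m∣d)

-- The indices |G_n : N_{1,n}| and |G_n : N_{2,n}| = |G_n : N_{3,n}|.
M₁ M₂ : ℕ → ℕ
M₁ zero = 1
M₁ (suc n) = 2 * M₂ n
M₂ zero = 1
M₂ (suc n) = M₁ n

M₁≡M₂⊎M₁≡2*M₂ : ∀ n → M₁ n ≡ M₂ n ⊎ M₁ n ≡ 2 * M₂ n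
M₁≡M₂⊎M₁≡2*M₂ zero = inj₁ refl
M₁≡M₂⊎M₁≡2*M₂ (suc n) with M₁≡M₂⊎M₁≡2*M₂ n
... | inj₁ M₁≡M₂ = inj₂ (cong (2 *_) (sym M₁≡M₂))
... | inj₂ M₁≡2*M₂ = inj₁ (sym M₁≡2*M₂)

M₂∣M₁ : ∀ n → M₂ n ℕ∣.∣ M₁ n
M₂∣M₁ n with M₁≡M₂⊎M₁≡2*M₂ n
... | inj₁ M₁≡M₂ = ℕ∣.∣-reflexive (sym M₁≡M₂)
... | inj₂ M₁≡2*M₂ = ℕ∣.divides 2 M₁≡2*M₂

M₂≤M₁ : ∀ n → M₂ n ≤ M₁ n
M₂≤M₁ n with M₁≡M₂⊎M₁≡2*M₂ n
... | inj₁ M₁≡M₂ = ℕ.≤-reflexive (sym M₁≡M₂)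
... | inj₂ M₁≡2*M₂ = subst (M₂ n ≤_) (sym M₁≡2*M₂) (ℕ.m≤m+n (M₂ n) _)

M₁≤2*M₂ : ∀ n → M₁ n ≤ 2 * M₂ n
M₁≤2*M₂ n with M₁≡M₂⊎M₁≡2*M₂ n
... | inj₁ M₁≡M₂ = subst (_≤ 2 * M₂ n) (sym M₁≡M₂) (ℕ.m≤m+n (M₂ n) _)
... | inj₂ M₁≡2*M₂ = ℕ.≤-reflexive M₁≡2*M₂

M₂-positive : ∀ n → 0 < M₂ n
M₂-positive zero = s≤s z≤n
M₂-positive (suc zero) = s≤s z≤n
M₂-positive (suc (suc n)) = ℕ.≤-trans (M₂-positive n) (ℕ.m≤m+n (M₂ n) _)

M₁-positive : ∀ n → 0 < M₁ n
M₁-positive n = ℕ.<-≤-trans (M₂-positive n) (M₂≤M₁ n)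

bit : Bool → ℤ
bit false = 0ℤ
bit true = 1ℤ

mutual
  φ₁ φ₂ φ₃ : ∀ {n} → Aut n → ℤ
  φ₁ leaf = 0ℤ
  φ₁ (node b u v) = + 2 ℤ.* φ₃ u + bit b
  φ₂ leaf = 0ℤ
  φ₂ (node b u v) = - (φ₁ u + φ₁ v)
  φ₃ x = φ₂ x - φ₁ x

φ-identity : ∀ n → φ₁ (idA n) ≡ 0ℤ × φ₂ (idA n) ≡ 0ℤ
φ-identity zero = refl , refl
φ-identity (suc n) rewrite proj₁ (φ-identity n) | proj₂ (φ-identity n) = refl , refl

φ₁-identity : ∀ n → φ₁ (idA n) ≡ 0ℤ
φ₁-identity n = proj₁ (φ-identity n)

φ₂-identity : ∀ n → φ₂ (idA n) ≡ 0ℤ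
φ₂-identity n = proj₂ (φ-identity n)

φ₃-identity : ∀ n → φ₃ (idA n) ≡ 0ℤ
φ₃-identity n rewrite φ₁-identity n | φ₂-identity n = refl

φ₁-generator φ₂-generator φ₃-generator : Gen → ℤ
φ₁-generator g1 = 0ℤ
φ₁-generator g2 = 1ℤ
φ₁-generator g3 = - 1ℤ
φ₂-generator g1 = 1ℤ
φ₂-generator g2 = 0ℤ
φ₂-generator g3 = - 1ℤ
φ₃-generator i = φ₂-generator i - φ₁-generator i

φ₁-on-generators : ∀ n i → φ₁ (a i n) ≡ φ₁-generator i [mod M₁ n ]
φ₂-on-generators : ∀ n i → φ₂ (a i n) ≡ φ₂-generator i [mod M₂ n ]

φ₃-on-generators : ∀ n i → φ₃ (a i n) ≡ φ₃-generator i [mod M₂ n ]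
φ₃-on-generators n i =
  mod-−-cong (φ₂-on-generators n i) (mod-weaken (M₂∣M₁ n) (φ₁-on-generators n i))

φ₁-on-generators zero i = mod-one _ _
φ₁-on-generators (suc n) g1 = mod-reflexive (cong (λ t → + 2 ℤ.* t + 0ℤ) (φ₃-identity n))
φ₁-on-generators (suc n) g2 = mod-reflexive (cong (λ t → + 2 ℤ.* t + 1ℤ) (φ₃-identity n))
φ₁-on-generators (suc n) g3 =
  mod-+-congʳ 1ℤ (mod-double (φ₃-on-generators n g2))

φ₂-on-generators zero i = mod-one _ _
φ₂-on-generators (suc n) g1 = mod-neg-cong (mod-+-cong (mod-reflexive (φ₁-identity n)) (φ₁-on-generators n g3))
φ₂-on-generators (suc n) g2 = mod-neg-cong (mod-+-cong (mod-reflexive (φ₁-identity n)) (φ₁-on-generators n g1))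
φ₂-on-generators (suc n) g3 = mod-neg-cong (mod-+-cong (φ₁-on-generators n g2) (mod-reflexive (φ₁-identity n)))

sectionˡ sectionʳ : ∀ {n} → Aut (suc n) → Aut n
sectionˡ (node b u v) = u
sectionʳ (node b u v) = v

swaps : ∀ {n} → Aut (suc n) → Bool
swaps (node b u v) = b

InG-sections : ∀ {n x} → InG (suc n) x → InG n (sectionˡ x) × InG n (sectionʳ x)
InG-sections (gen g1) = one , gen g3
InG-sections (gen g2) = one , gen g1
InG-sections (gen g3) = gen g2 , one
InG-sections one = one , one
InG-sections (mul {node false _ _} {node _ _ _} p q) =
  mul (proj₁ (InG-sections p)) (proj₁ (InG-sections q)) , mul (proj₂ (InG-sections p)) (proj₂ (InG-sections q))
InG-sections (mul {node true _ _} {node _ _ _} p q) =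
  mul (proj₁ (InG-sections p)) (proj₂ (InG-sections q)) , mul (proj₂ (InG-sections p)) (proj₁ (InG-sections q))
InG-sections (inv {node false _ _} p) = inv (proj₁ (InG-sections p)) , inv (proj₂ (InG-sections p))
InG-sections (inv {node true _ _} p) = inv (proj₂ (InG-sections p)) , inv (proj₁ (InG-sections p))

Additive : (n M : ℕ) → (Aut n → ℤ) → Set
Additive n M φ = ∀ {x y} → InG n x → InG n y → φ (x ∘A y) ≡ φ x + φ y [mod M ]

additive-weaken : ∀ {n M d} φ → d ℕ∣.∣ M → Additive n M φ → Additive n d φ
additive-weaken φ d∣M φ-hom p q = mod-weaken d∣M (φ-hom p q)

additive-− : ∀ {n M} φ ψ → Additive n M φ → Additive n M ψ → Additive n M (λ x → φ x - ψ x)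
additive-− {n} {M} φ ψ φ-hom ψ-hom {x} {y} p q = begin
  φ (x ∘A y) - ψ (x ∘A y)     ≈⟨ mod-−-cong (φ-hom p q) (ψ-hom p q) ⟩
  (φ x + φ y) - (ψ x + ψ y)   ≡⟨ interchange (φ x) (φ y) (ψ x) (ψ y) ⟩
  (φ x - ψ x) + (φ y - ψ y)   ∎
  where
  open ModReasoning M
  interchange : ∀ a b c d → (a + b) - (c + d) ≡ (a - c) + (b - d)
  interchange = solve-∀

additive-inv : ∀ {n M φ} → φ (idA n) ≡ 0ℤ → Additive n M φ →
               ∀ {x} → InG n x → φ (invA x) ≡ - φ x [mod M ]
additive-inv {n} {M} {φ} φ-id φ-hom {x} p = begin
  φ (invA x)                   ≡⟨ cancel (φ x) (φ (invA x)) ⟩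
  - φ x + (φ x + φ (invA x))   ≈⟨ mod-+-congˡ (- φ x) (φ-hom p (inv p)) ⟨
  - φ x + φ (x ∘A invA x)      ≡⟨ cong (λ t → - φ x + φ t) (invA-inverseʳ x) ⟩
  - φ x + φ (idA n)            ≡⟨ cong (λ t → - φ x + t) φ-id ⟩
  - φ x + 0ℤ                   ≡⟨ ℤ.+-identityʳ (- φ x) ⟩
  - φ x                        ∎
  where
  open ModReasoning M
  cancel : ∀ a b → b ≡ - a + (a + b)
  cancel = solve-∀

bit-not : ∀ b → bit (not b) ≡ 1ℤ - bit b
bit-not false = refl
bit-not true = refl

φ₃-sections : ∀ {n} → Additive n (M₂ n) φ₃ → ∀ {x} → InG (suc n) x →
              φ₃ (sectionʳ x) - φ₃ (sectionˡ x) ≡ bit (swaps x) [mod M₂ n ]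
φ₃-sections {n} φ₃-hom = δ
  where
  open ModReasoning (M₂ n)
  φ₃-inv : ∀ {x} → InG n x → φ₃ (invA x) ≡ - φ₃ x [mod M₂ n ]
  φ₃-inv = additive-inv (φ₃-identity n) φ₃-hom

  δ : ∀ {x} → InG (suc n) x → φ₃ (sectionʳ x) - φ₃ (sectionˡ x) ≡ bit (swaps x) [mod M₂ n ]
  δ (gen g1) = mod-−-cong (φ₃-on-generators n g3) (mod-reflexive (φ₃-identity n))
  δ (gen g2) = mod-−-cong (φ₃-on-generators n g1) (mod-reflexive (φ₃-identity n))
  δ (gen g3) = mod-−-cong (mod-reflexive (φ₃-identity n)) (φ₃-on-generators n g2)
  δ one = mod-reflexive (cong₂ _-_ (φ₃-identity n) (φ₃-identity n))
  δ (mul {node false u v} {node c u' v'} p q) with InG-sections p | InG-sections q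
  ... | pu , pv | qu , qv = begin
    φ₃ (v ∘A v') - φ₃ (u ∘A u')              ≈⟨ mod-−-cong (φ₃-hom pv qv) (φ₃-hom pu qu) ⟩
    (φ₃ v + φ₃ v') - (φ₃ u + φ₃ u')          ≡⟨ regroup (φ₃ v) (φ₃ v') (φ₃ u) (φ₃ u') ⟩
    (φ₃ v - φ₃ u) + (φ₃ v' - φ₃ u')          ≈⟨ mod-+-cong (δ p) (δ q) ⟩
    0ℤ + bit c                               ≡⟨ ℤ.+-identityˡ (bit c) ⟩
    bit c                                    ∎
    where
    regroup : ∀ a b c d → (a + b) - (c + d) ≡ (a - c) + (b - d)
    regroup = solve-∀
  δ (mul {node true u v} {node c u' v'} p q) with InG-sections p | InG-sections q
  ... | pu , pv | qu , qv = begin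
    φ₃ (v ∘A u') - φ₃ (u ∘A v')              ≈⟨ mod-−-cong (φ₃-hom pv qu) (φ₃-hom pu qv) ⟩
    (φ₃ v + φ₃ u') - (φ₃ u + φ₃ v')          ≡⟨ regroup (φ₃ v) (φ₃ u') (φ₃ u) (φ₃ v') ⟩
    (φ₃ v - φ₃ u) - (φ₃ v' - φ₃ u')          ≈⟨ mod-−-cong (δ p) (δ q) ⟩
    1ℤ - bit c                               ≡⟨ bit-not c ⟨
    bit (not c)                              ∎
    where
    regroup : ∀ a b c d → (a + b) - (c + d) ≡ (a - c) - (d - b)
    regroup = solve-∀
  δ (inv {node false u v} p) with InG-sections p
  ... | pu , pv = begin
    φ₃ (invA v) - φ₃ (invA u)                ≈⟨ mod-−-cong (φ₃-inv pv) (φ₃-inv pu) ⟩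
    - φ₃ v - - φ₃ u                          ≡⟨ regroup (φ₃ v) (φ₃ u) ⟩
    - (φ₃ v - φ₃ u)                          ≈⟨ mod-neg-cong (δ p) ⟩
    0ℤ                                       ∎
    where
    regroup : ∀ a b → - a - - b ≡ - (a - b)
    regroup = solve-∀
  δ (inv {node true u v} p) with InG-sections p
  ... | pu , pv = begin
    φ₃ (invA u) - φ₃ (invA v)                ≈⟨ mod-−-cong (φ₃-inv pu) (φ₃-inv pv) ⟩
    - φ₃ u - - φ₃ v                          ≡⟨ regroup (φ₃ u) (φ₃ v) ⟩
    φ₃ v - φ₃ u                              ≈⟨ δ p ⟩
    1ℤ                                       ∎
    where
    regroup : ∀ a b → - a - - b ≡ b - a
    regroup = solve-∀

φ₂-additive-step : ∀ {n} → Additive n (M₁ n) φ₁ → Additive (suc n) (M₂ (suc n)) φ₂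
φ₂-additive-step {n} φ₁-hom {node false u v} {node c u' v'} p q with InG-sections p | InG-sections q
... | pu , pv | qu , qv = begin
  - (φ₁ (u ∘A u') + φ₁ (v ∘A v'))                  ≈⟨ mod-neg-cong (mod-+-cong (φ₁-hom pu qu) (φ₁-hom pv qv)) ⟩
  - ((φ₁ u + φ₁ u') + (φ₁ v + φ₁ v'))              ≡⟨ regroup (φ₁ u) (φ₁ u') (φ₁ v) (φ₁ v') ⟩
  - (φ₁ u + φ₁ v) + - (φ₁ u' + φ₁ v')              ∎
  where
  open ModReasoning (M₁ n)
  regroup : ∀ a b c d → - ((a + b) + (c + d)) ≡ - (a + c) + - (b + d)
  regroup = solve-∀
φ₂-additive-step {n} φ₁-hom {node true u v} {node c u' v'} p q with InG-sections p | InG-sections q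
... | pu , pv | qu , qv = begin
  - (φ₁ (u ∘A v') + φ₁ (v ∘A u'))                  ≈⟨ mod-neg-cong (mod-+-cong (φ₁-hom pu qv) (φ₁-hom pv qu)) ⟩
  - ((φ₁ u + φ₁ v') + (φ₁ v + φ₁ u'))              ≡⟨ regroup (φ₁ u) (φ₁ v') (φ₁ v) (φ₁ u') ⟩
  - (φ₁ u + φ₁ v) + - (φ₁ u' + φ₁ v')              ∎
  where
  open ModReasoning (M₁ n)
  regroup : ∀ a b c d → - ((a + b) + (c + d)) ≡ - (a + c) + - (d + b)
  regroup = solve-∀

φ₁-additive-step : ∀ {n} → Additive n (M₂ n) φ₃ → Additive (suc n) (M₁ (suc n)) φ₁
φ₁-additive-step {n} φ₃-hom {node false u v} {node c u' v'} p q with InG-sections p | InG-sections q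
... | pu , _ | qu , _ = begin
  + 2 ℤ.* φ₃ (u ∘A u') + bit c                     ≈⟨ mod-+-congʳ (bit c) (mod-double (φ₃-hom pu qu)) ⟩
  + 2 ℤ.* (φ₃ u + φ₃ u') + bit c                   ≡⟨ regroup (φ₃ u) (φ₃ u') (bit c) ⟩
  (+ 2 ℤ.* φ₃ u + 0ℤ) + (+ 2 ℤ.* φ₃ u' + bit c)    ∎
  where
  open ModReasoning (M₁ (suc n))
  regroup : ∀ a b c → + 2 ℤ.* (a + b) + c ≡ (+ 2 ℤ.* a + 0ℤ) + (+ 2 ℤ.* b + c)
  regroup = solve-∀
φ₁-additive-step {n} φ₃-hom {node true u v} {node c u' v'} p q with InG-sections p | InG-sections q
... | pu , _ | _ , qv = begin
  + 2 ℤ.* φ₃ (u ∘A v') + bit (not c)                     ≈⟨ mod-+-congʳ (bit (not c)) (mod-double (φ₃-hom pu qv)) ⟩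
  + 2 ℤ.* (φ₃ u + φ₃ v') + bit (not c)                   ≡⟨ cong (λ t → + 2 ℤ.* t + bit (not c)) (split (φ₃ u) (φ₃ u') (φ₃ v')) ⟩
  + 2 ℤ.* (φ₃ u + (φ₃ u' + (φ₃ v' - φ₃ u'))) + bit (not c)
    ≈⟨ mod-+-congʳ (bit (not c)) (mod-double (mod-+-congˡ (φ₃ u) (mod-+-congˡ (φ₃ u') (φ₃-sections φ₃-hom q)))) ⟩
  + 2 ℤ.* (φ₃ u + (φ₃ u' + bit c)) + bit (not c)         ≡⟨ cong (λ t → + 2 ℤ.* (φ₃ u + (φ₃ u' + bit c)) + t) (bit-not c) ⟩
  + 2 ℤ.* (φ₃ u + (φ₃ u' + bit c)) + (1ℤ - bit c)        ≡⟨ regroup (φ₃ u) (φ₃ u') (bit c) ⟩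
  (+ 2 ℤ.* φ₃ u + 1ℤ) + (+ 2 ℤ.* φ₃ u' + bit c)          ∎
  where
  open ModReasoning (M₁ (suc n))
  split : ∀ a b d → a + d ≡ a + (b + (d - b))
  split = solve-∀
  regroup : ∀ a b c → + 2 ℤ.* (a + (b + c)) + (1ℤ - c) ≡ (+ 2 ℤ.* a + 1ℤ) + (+ 2 ℤ.* b + c)
  regroup = solve-∀

φ₁-additive : ∀ n → Additive n (M₁ n) φ₁
φ₂-additive : ∀ n → Additive n (M₂ n) φ₂

φ₃-additive : ∀ n → Additive n (M₂ n) φ₃
φ₃-additive n = additive-− φ₂ φ₁ (φ₂-additive n) (additive-weaken φ₁ (M₂∣M₁ n) (φ₁-additive n))

φ₁-additive zero _ _ = mod-one _ _
φ₁-additive (suc n) = φ₁-additive-step (φ₃-additive n)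
φ₂-additive zero _ _ = mod-one _ _
φ₂-additive (suc n) = φ₂-additive-step (φ₁-additive n)

record IsNormalSubgroup (n : ℕ) (P : Aut n → Set) : Set where
  field
    ∈-id   : P (idA n)
    ∈-∘    : ∀ {x y} → P x → P y → P (x ∘A y)
    ∈-inv  : ∀ {x} → P x → P (invA x)
    ∈-conj : ∀ {g x} → InG n g → P x → P (g ∘A x ∘A invA g)

InN-isNormalSubgroup : ∀ n i → IsNormalSubgroup n (InN n i)
InN-isNormalSubgroup n i = record { ∈-id = one ; ∈-∘ = mul ; ∈-inv = inv ; ∈-conj = conj }

InG-powℕ : ∀ {n x} k → InG n x → InG n (powℕ x k)
InG-powℕ zero p = one
InG-powℕ (suc k) p = mul p (InG-powℕ k p)

powℕ-+ : ∀ {n} (x : Aut n) j k → powℕ x (j ℕ.+ k) ≡ powℕ x j ∘A powℕ x k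
powℕ-+ x zero k = sym (∘A-identityˡ (powℕ x k))
powℕ-+ x (suc j) k = trans (cong (x ∘A_) (powℕ-+ x j k)) (sym (∘A-assoc x (powℕ x j) (powℕ x k)))

powℕ-* : ∀ {n} (x : Aut n) j k → powℕ x (j * k) ≡ powℕ (powℕ x k) j
powℕ-* x zero k = refl
powℕ-* x (suc j) k = trans (powℕ-+ x k (j * k)) (cong (powℕ x k ∘A_) (powℕ-* x j k))

powℕ-id : ∀ n k → powℕ (idA n) k ≡ idA n
powℕ-id n zero = refl
powℕ-id n (suc k) = trans (∘A-identityˡ _) (powℕ-id n k)

⁅_,_⁆ : ∀ {n} → Aut n → Aut n → Aut n
⁅ x , y ⁆ = x ∘A y ∘A invA x ∘A invA y

⁅,⁆-as-quotient : ∀ {n} (x y : Aut n) → (x ∘A y) ∘A invA (y ∘A x) ≡ ⁅ x , y ⁆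
⁅,⁆-as-quotient x y = trans (cong ((x ∘A y) ∘A_) (⁻¹-anti-homo-∙ y x)) (sym (∘A-assoc _ _ _))

module NormalSubgroupProperties {n : ℕ} {P : Aut n → Set} (N : IsNormalSubgroup n P) where
  open IsNormalSubgroup N
  open ≡-Reasoning

  -- Equality of right cosets, the convention of QuotOrder.
  infix 4 _≈_
  _≈_ : Aut n → Aut n → Set
  x ≈ y = P (x ∘A invA y)

  ∈⇒≈id : ∀ {x} → P x → x ≈ idA n
  ∈⇒≈id {x} = subst P (sym (trans (cong (x ∘A_) ε⁻¹≈ε) (∘A-identityʳ x)))

  ≈id⇒∈ : ∀ {x} → x ≈ idA n → P x
  ≈id⇒∈ {x} = subst P (trans (cong (x ∘A_) ε⁻¹≈ε) (∘A-identityʳ x))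

  ≈-reflexive : ∀ {x y} → x ≡ y → x ≈ y
  ≈-reflexive {x} refl = subst P (sym (invA-inverseʳ x)) ∈-id

  ≈-refl : ∀ {x} → x ≈ x
  ≈-refl = ≈-reflexive refl

  ≈-sym : ∀ {x y} → x ≈ y → y ≈ x
  ≈-sym {x} {y} = subst P (begin
    invA (x ∘A invA y)          ≡⟨ ⁻¹-anti-homo-∙ x (invA y) ⟩
    invA (invA y) ∘A invA x     ≡⟨ cong (_∘A invA x) (⁻¹-involutive y) ⟩
    y ∘A invA x                 ∎) ∘ ∈-inv

  ≈-trans : ∀ {x y z} → x ≈ y → y ≈ z → x ≈ z
  ≈-trans {x} {y} {z} x≈y y≈z = subst P (begin
    (x ∘A invA y) ∘A (y ∘A invA z)    ≡⟨ ∘A-assoc x (invA y) (y ∘A invA z) ⟩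
    x ∘A (invA y ∘A (y ∘A invA z))    ≡⟨ cong (x ∘A_) (∘A-assoc (invA y) y (invA z)) ⟨
    x ∘A ((invA y ∘A y) ∘A invA z)    ≡⟨ cong (λ t → x ∘A (t ∘A invA z)) (invA-inverseˡ y) ⟩
    x ∘A (idA n ∘A invA z)            ≡⟨ cong (x ∘A_) (∘A-identityˡ (invA z)) ⟩
    x ∘A invA z                       ∎) (∈-∘ x≈y y≈z)

  ≈-setoid : Setoid 0ℓ 0ℓ
  ≈-setoid = record
    { Carrier = Aut n
    ; _≈_ = _≈_
    ; isEquivalence = record { refl = ≈-refl ; sym = ≈-sym ; trans = ≈-trans }
    }

  module ≈-Reasoning = SetoidReasoning ≈-setoid

  ∘-congʳ : ∀ {x y} h → x ≈ y → x ∘A h ≈ y ∘A h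
  ∘-congʳ {x} {y} h = subst P (begin
    x ∘A invA y                                 ≡⟨ cong (x ∘A_) (∘A-identityˡ (invA y)) ⟨
    x ∘A (idA n ∘A invA y)                      ≡⟨ cong (λ t → x ∘A (t ∘A invA y)) (invA-inverseʳ h) ⟨
    x ∘A ((h ∘A invA h) ∘A invA y)              ≡⟨ cong (x ∘A_) (∘A-assoc h (invA h) (invA y)) ⟩
    x ∘A (h ∘A (invA h ∘A invA y))              ≡⟨ ∘A-assoc x h _ ⟨
    (x ∘A h) ∘A (invA h ∘A invA y)              ≡⟨ cong ((x ∘A h) ∘A_) (⁻¹-anti-homo-∙ y h) ⟨
    (x ∘A h) ∘A invA (y ∘A h)                   ∎)

  ∘-congˡ : ∀ {x y g} → InG n g → x ≈ y → g ∘A x ≈ g ∘A y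
  ∘-congˡ {x} {y} {g} g∈G = subst P (begin
    g ∘A (x ∘A invA y) ∘A invA g                ≡⟨ cong (_∘A invA g) (∘A-assoc g x (invA y)) ⟨
    ((g ∘A x) ∘A invA y) ∘A invA g              ≡⟨ ∘A-assoc (g ∘A x) (invA y) (invA g) ⟩
    (g ∘A x) ∘A (invA y ∘A invA g)              ≡⟨ cong ((g ∘A x) ∘A_) (⁻¹-anti-homo-∙ g y) ⟨
    (g ∘A x) ∘A invA (g ∘A y)                   ∎) ∘ ∈-conj g∈G

  ∘-cong : ∀ {x x′ y y′} → InG n x → x ≈ x′ → y ≈ y′ → x ∘A y ≈ x′ ∘A y′
  ∘-cong {y′ = y′} x∈G x≈x′ y≈y′ = ≈-trans (∘-congˡ x∈G y≈y′) (∘-congʳ y′ x≈x′)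

  inv-cong : ∀ {x y} → InG n x → x ≈ y → invA x ≈ invA y
  inv-cong {x} {y} x∈G = subst P (begin
    invA x ∘A invA (x ∘A invA y) ∘A invA (invA x)   ≡⟨ cong₂ (λ s t → invA x ∘A s ∘A t) (⁻¹-anti-homo-∙ x (invA y)) (⁻¹-involutive x) ⟩
    invA x ∘A (invA (invA y) ∘A invA x) ∘A x       ≡⟨ cong (λ t → invA x ∘A (t ∘A invA x) ∘A x) (⁻¹-involutive y) ⟩
    invA x ∘A (y ∘A invA x) ∘A x                   ≡⟨ ∘A-assoc (invA x) (y ∘A invA x) x ⟩
    invA x ∘A ((y ∘A invA x) ∘A x)                 ≡⟨ cong (invA x ∘A_) (∘A-assoc y (invA x) x) ⟩
    invA x ∘A (y ∘A (invA x ∘A x))                 ≡⟨ cong (λ t → invA x ∘A (y ∘A t)) (invA-inverseˡ x) ⟩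
    invA x ∘A (y ∘A idA n)                         ≡⟨ cong (invA x ∘A_) (∘A-identityʳ y) ⟩
    invA x ∘A y                                    ≡⟨ cong (invA x ∘A_) (⁻¹-involutive y) ⟨
    invA x ∘A invA (invA y)                        ∎) ∘ ∈-conj (inv x∈G) ∘ ∈-inv

  powℕ-cong : ∀ {x y} k → InG n x → x ≈ y → powℕ x k ≈ powℕ y k
  powℕ-cong zero x∈G x≈y = ≈-refl
  powℕ-cong (suc k) x∈G x≈y = ∘-cong x∈G x≈y (powℕ-cong k x∈G x≈y)

  ∈-powℕ : ∀ {x} k → InG n x → P x → P (powℕ x k)
  ∈-powℕ k x∈G x∈P = ≈id⇒∈ (≈-trans (powℕ-cong k x∈G (∈⇒≈id x∈P)) (≈-reflexive (powℕ-id n k)))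

  ∈⇒≈inv : ∀ {x y} → P (x ∘A y) → x ≈ invA y
  ∈⇒≈inv {x} {y} = subst P (cong (x ∘A_) (sym (⁻¹-involutive y)))

  ∈-swap : ∀ {x y} → InG n x → P (x ∘A y) → P (y ∘A x)
  ∈-swap {x} {y} x∈G xy∈P = subst P (begin
    invA x ∘A (x ∘A y) ∘A invA (invA x)     ≡⟨ cong₂ _∘A_ (sym (∘A-assoc (invA x) x y)) (⁻¹-involutive x) ⟩
    (invA x ∘A x) ∘A y ∘A x                 ≡⟨ cong (λ t → t ∘A y ∘A x) (invA-inverseˡ x) ⟩
    idA n ∘A y ∘A x                         ≡⟨ cong (_∘A x) (∘A-identityˡ y) ⟩
    y ∘A x                                  ∎) (∈-conj (inv x∈G) xy∈P)

  ⁅,⁆-∈ˡ : ∀ {x y} → P x → InG n y → P ⁅ x , y ⁆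
  ⁅,⁆-∈ˡ {x} {y} x∈P y∈G = subst P (begin
    x ∘A (y ∘A invA x ∘A invA y)        ≡⟨ ∘A-assoc x (y ∘A invA x) (invA y) ⟨
    x ∘A (y ∘A invA x) ∘A invA y        ≡⟨ cong (_∘A invA y) (∘A-assoc x y (invA x)) ⟨
    ⁅ x , y ⁆                           ∎) (∈-∘ x∈P (∈-conj y∈G (∈-inv x∈P)))

  ⁅,⁆-∈ʳ : ∀ {x y} → InG n x → P y → P ⁅ x , y ⁆
  ⁅,⁆-∈ʳ x∈G y∈P = ∈-∘ (∈-conj x∈G y∈P) (∈-inv y∈P)

  ⁅,⁆-∈-∘ : ∀ {x y} → InG n x → P (x ∘A y) → P ⁅ x , y ⁆
  ⁅,⁆-∈-∘ {x} {y} x∈G xy∈P = subst P (⁅,⁆-as-quotient x y) (∈-∘ xy∈P (∈-inv (∈-swap x∈G xy∈P)))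

  ∘-∈ʳ : ∀ {x y} → InG n x → P y → x ∘A y ≈ x
  ∘-∈ʳ {x} x∈G y∈P = ≈-trans (∘-congˡ x∈G (∈⇒≈id y∈P)) (≈-reflexive (∘A-identityʳ x))

  ∈-powℕ-∣ : ∀ {x d m} → d ℕ∣.∣ m → InG n x → P (powℕ x d) → P (powℕ x m)
  ∈-powℕ-∣ {x} {d} (ℕ∣.divides q refl) x∈G xᵈ∈P =
    subst P (sym (powℕ-* x q d)) (∈-powℕ q (InG-powℕ d x∈G) xᵈ∈P)

  module _ {c} M .{{_ : NonZero M}} (c∈G : InG n c) (cᴹ∈P : P (powℕ c M)) where

    powℕ-mod : ∀ k → powℕ c k ≈ powℕ c (k % M)
    powℕ-mod k = ≈-trans (≈-reflexive (begin
      powℕ c k                                   ≡⟨ cong (powℕ c) (m≡m%n+[m/n]*n k M) ⟩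
      powℕ c (k % M ℕ.+ (k / M) * M)             ≡⟨ powℕ-+ c (k % M) ((k / M) * M) ⟩
      powℕ c (k % M) ∘A powℕ c ((k / M) * M)     ≡⟨ cong (powℕ c (k % M) ∘A_) (powℕ-* c (k / M) M) ⟩
      powℕ c (k % M) ∘A powℕ (powℕ c M) (k / M)  ∎))
      (∘-∈ʳ (InG-powℕ (k % M) c∈G) (∈-powℕ (k / M) (InG-powℕ M c∈G) cᴹ∈P))

    powℕ-inv : ∀ k → invA (powℕ c k) ≈ powℕ c (pred M * k)
    powℕ-inv k = ≈-sym (∈⇒≈inv (subst P (begin
      powℕ (powℕ c M) k                      ≡⟨ powℕ-* c k M ⟨
      powℕ c (k * M)                         ≡⟨ cong (powℕ c) (ℕ.*-comm k M) ⟩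
      powℕ c (M * k)                         ≡⟨ cong (λ m → powℕ c (m * k)) (ℕ.suc-pred M) ⟨
      powℕ c (k ℕ.+ pred M * k)              ≡⟨ cong (powℕ c) (ℕ.+-comm k (pred M * k)) ⟩
      powℕ c (pred M * k ℕ.+ k)              ≡⟨ powℕ-+ c (pred M * k) k ⟩
      powℕ c (pred M * k) ∘A powℕ c k        ∎) (∈-powℕ k (InG-powℕ M c∈G) cᴹ∈P)))

    inv≈powℕ-pred : invA c ≈ powℕ c (pred M)
    inv≈powℕ-pred = ≈-trans (≈-reflexive (cong invA (sym (∘A-identityʳ c))))
      (≈-trans (powℕ-inv 1) (≈-reflexive (cong (powℕ c) (ℕ.*-identityʳ (pred M)))))

generator-relations : ∀ n → (a g1 n ∘A a g2 n) ∘A a g3 n ≡ idA n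
                          × (a g2 n ∘A a g3 n) ∘A a g1 n ≡ idA n
                          × (a g3 n ∘A a g1 n) ∘A a g2 n ≡ idA n
generator-relations zero = refl , refl , refl
generator-relations (suc n) =
    cong₂ (node false) id³ (proj₂ (proj₂ (generator-relations n)))
  , cong₂ (node false) id³ (proj₁ (generator-relations n))
  , cong₂ (node false) (proj₁ (proj₂ (generator-relations n))) id³
  where
  id³ : (idA n ∘A idA n) ∘A idA n ≡ idA n
  id³ = trans (∘A-identityʳ _) (∘A-identityˡ _)

InN-from-relation : ∀ {n i x y} → (x ∘A y) ∘A a i n ≡ idA n → InN n i (x ∘A y)
InN-from-relation {n} {i} {x} {y} xyaᵢ≡id =
  subst (InN n i) (sym (inverseˡ-unique (x ∘A y) (a i n) xyaᵢ≡id)) (inv base)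

data InG′ (n : ℕ) : Aut n → Set where
  base : InG′ n ⁅ a g1 n , a g2 n ⁆
  one  : InG′ n (idA n)
  mul  : {x y : Aut n} → InG′ n x → InG′ n y → InG′ n (x ∘A y)
  inv  : {x : Aut n} → InG′ n x → InG′ n (invA x)
  conj : {g x : Aut n} → InG n g → InG′ n x → InG′ n (g ∘A x ∘A invA g)

InG′-isNormalSubgroup : ∀ n → IsNormalSubgroup n (InG′ n)
InG′-isNormalSubgroup n = record { ∈-id = one ; ∈-∘ = mul ; ∈-inv = inv ; ∈-conj = conj }

module Abelianisation (n : ℕ) where
  open NormalSubgroupProperties (InG′-isNormalSubgroup n)
  open ≈-Reasoning

  Commute : Aut n → Aut n → Set
  Commute x y = x ∘A y ≈ y ∘A x

  commute-∘ : ∀ {x y z} → InG n y → Commute x y → Commute x z → Commute x (y ∘A z)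
  commute-∘ {x} {y} {z} y∈G xy≈yx xz≈zx = begin
    x ∘A (y ∘A z)      ≡⟨ ∘A-assoc x y z ⟨
    (x ∘A y) ∘A z      ≈⟨ ∘-congʳ z xy≈yx ⟩
    (y ∘A x) ∘A z      ≡⟨ ∘A-assoc y x z ⟩
    y ∘A (x ∘A z)      ≈⟨ ∘-congˡ y∈G xz≈zx ⟩
    y ∘A (z ∘A x)      ≡⟨ ∘A-assoc y z x ⟨
    (y ∘A z) ∘A x      ∎

  commute-inv : ∀ {x y} → InG n y → Commute x y → Commute x (invA y)
  commute-inv {x} {y} y∈G xy≈yx = begin
    x ∘A invA y                          ≡⟨ cancelˡ (x ∘A invA y) ⟨
    invA y ∘A (y ∘A (x ∘A invA y))       ≡⟨ cong (invA y ∘A_) (∘A-assoc y x (invA y)) ⟨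
    invA y ∘A ((y ∘A x) ∘A invA y)       ≈⟨ ∘-congˡ (inv y∈G) (∘-congʳ (invA y) xy≈yx) ⟨
    invA y ∘A ((x ∘A y) ∘A invA y)       ≡⟨ cong (invA y ∘A_) (cancelʳ x) ⟩
    invA y ∘A x                          ∎
    where
    cancelˡ : ∀ z → invA y ∘A (y ∘A z) ≡ z
    cancelˡ z = trans (sym (∘A-assoc (invA y) y z)) (trans (cong (_∘A z) (invA-inverseˡ y)) (∘A-identityˡ z))
    cancelʳ : ∀ z → (z ∘A y) ∘A invA y ≡ z
    cancelʳ z = trans (∘A-assoc z y (invA y)) (trans (cong (z ∘A_) (invA-inverseʳ y)) (∘A-identityʳ z))

  a₃≡[a₁∘a₂]⁻¹ : a g3 n ≡ invA (a g1 n ∘A a g2 n)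
  a₃≡[a₁∘a₂]⁻¹ = inverseʳ-unique (a g1 n ∘A a g2 n) (a g3 n) (proj₁ (generator-relations n))

  commute-InG : ∀ {x} → Commute x (a g1 n) → Commute x (a g2 n) → ∀ {y} → InG n y → Commute x y
  commute-InG x≈₁ x≈₂ (gen g1) = x≈₁
  commute-InG x≈₁ x≈₂ (gen g2) = x≈₂
  commute-InG {x} x≈₁ x≈₂ (gen g3) =
    subst (Commute x) (sym a₃≡[a₁∘a₂]⁻¹) (commute-inv (mul (gen g1) (gen g2)) (commute-∘ (gen g1) x≈₁ x≈₂))
  commute-InG {x} x≈₁ x≈₂ one = ≈-reflexive (trans (∘A-identityʳ x) (sym (∘A-identityˡ x)))
  commute-InG x≈₁ x≈₂ (mul y∈G z∈G) = commute-∘ y∈G (commute-InG x≈₁ x≈₂ y∈G) (commute-InG x≈₁ x≈₂ z∈G)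
  commute-InG x≈₁ x≈₂ (inv y∈G) = commute-inv y∈G (commute-InG x≈₁ x≈₂ y∈G)

  commute : ∀ {x y} → InG n x → InG n y → Commute x y
  commute x∈G y∈G = commute-InG (≈-sym (a₁-commute x∈G)) (≈-sym (a₂-commute x∈G)) y∈G
    where
    a₁a₂≈a₂a₁ : Commute (a g1 n) (a g2 n)
    a₁a₂≈a₂a₁ = subst (InG′ n) (sym (⁅,⁆-as-quotient (a g1 n) (a g2 n))) base
    a₁-commute : ∀ {z} → InG n z → Commute (a g1 n) z
    a₁-commute = commute-InG ≈-refl a₁a₂≈a₂a₁
    a₂-commute : ∀ {z} → InG n z → Commute (a g2 n) z
    a₂-commute = commute-InG (≈-sym a₁a₂≈a₂a₁) ≈-refl

  powℕ-∘-distrib : ∀ {x y} → InG n x → InG n y → ∀ k → powℕ (x ∘A y) k ≈ powℕ x k ∘A powℕ y k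
  powℕ-∘-distrib x∈G y∈G zero = ≈-reflexive (sym (∘A-identityˡ (idA n)))
  powℕ-∘-distrib {x} {y} x∈G y∈G (suc k) = begin
    (x ∘A y) ∘A powℕ (x ∘A y) k        ≈⟨ ∘-congˡ (mul x∈G y∈G) (powℕ-∘-distrib x∈G y∈G k) ⟩
    (x ∘A y) ∘A (xᵏ ∘A yᵏ)             ≡⟨ ∘A-assoc x y (xᵏ ∘A yᵏ) ⟩
    x ∘A (y ∘A (xᵏ ∘A yᵏ))             ≡⟨ cong (x ∘A_) (∘A-assoc y xᵏ yᵏ) ⟨
    x ∘A ((y ∘A xᵏ) ∘A yᵏ)             ≈⟨ ∘-congˡ x∈G (∘-congʳ yᵏ (commute y∈G (InG-powℕ k x∈G))) ⟩
    x ∘A ((xᵏ ∘A y) ∘A yᵏ)             ≡⟨ cong (x ∘A_) (∘A-assoc xᵏ y yᵏ) ⟩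
    x ∘A (xᵏ ∘A (y ∘A yᵏ))             ≡⟨ ∘A-assoc x xᵏ (y ∘A yᵏ) ⟨
    (x ∘A xᵏ) ∘A (y ∘A yᵏ)             ∎
    where
    xᵏ yᵏ : Aut n
    xᵏ = powℕ x k
    yᵏ = powℕ y k

InG′⊆InN : ∀ {n} i {x} → InG′ n x → InN n i x
InG′⊆InN {n} g1 base = NormalSubgroupProperties.⁅,⁆-∈ˡ (InN-isNormalSubgroup n g1) base (gen g2)
InG′⊆InN {n} g2 base = NormalSubgroupProperties.⁅,⁆-∈ʳ (InN-isNormalSubgroup n g2) (gen g1) base
InG′⊆InN {n} g3 base = NormalSubgroupProperties.⁅,⁆-∈-∘ (InN-isNormalSubgroup n g3) (gen g1)
  (InN-from-relation (proj₁ (generator-relations n)))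
InG′⊆InN i one = one
InG′⊆InN i (mul p q) = mul (InG′⊆InN i p) (InG′⊆InN i q)
InG′⊆InN i (inv p) = inv (InG′⊆InN i p)
InG′⊆InN i (conj g p) = conj g (InG′⊆InN i p)

⁅,⁆-∈G′ : ∀ {n x y} → InG n x → InG n y → InG′ n ⁅ x , y ⁆
⁅,⁆-∈G′ {n} {x} {y} x∈G y∈G = subst (InG′ n) (⁅,⁆-as-quotient x y) (Abelianisation.commute n x∈G y∈G)

⁅x,x⁻¹⁆≡id : ∀ {n} (x : Aut n) → ⁅ x , invA x ⁆ ≡ idA n
⁅x,x⁻¹⁆≡id {n} x = begin
  x ∘A invA x ∘A invA x ∘A invA (invA x)     ≡⟨ cong (λ t → t ∘A invA x ∘A invA (invA x)) (invA-inverseʳ x) ⟩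
  idA n ∘A invA x ∘A invA (invA x)           ≡⟨ cong (_∘A invA (invA x)) (∘A-identityˡ (invA x)) ⟩
  invA x ∘A invA (invA x)                    ≡⟨ invA-inverseʳ (invA x) ⟩
  idA n                                      ∎
  where open ≡-Reasoning

diag : ∀ {n} → Aut n → Aut (suc n)
diag x = node false x x

embedʳ : ∀ {n} → Aut n → Aut (suc n)
embedʳ {n} x = node false (idA n) x

InG-diag : ∀ {n g} → InG n g → InG (suc n) (diag g)
InG-diag {n} (gen g1) = subst (InG (suc n)) (cong₂ (node false) (∘A-identityˡ _) (∘A-identityʳ _)) (mul (gen g2) (gen g2))
InG-diag {n} (gen g2) = subst (InG (suc n)) (cong₂ (node false) (∘A-identityʳ _) (∘A-identityˡ _)) (mul (gen g3) (gen g3))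
InG-diag {n} (gen g3) = subst (InG (suc n)) (cong₂ (node false) left right)
                    (mul (mul (mul (gen g2) (gen g1)) (inv (gen g2))) (gen g1))
  where
  open ≡-Reasoning
  left : (idA n ∘A a g3 n) ∘A invA (idA n) ∘A idA n ≡ a g3 n
  left = begin
    (idA n ∘A a g3 n) ∘A invA (idA n) ∘A idA n  ≡⟨ ∘A-identityʳ _ ⟩
    (idA n ∘A a g3 n) ∘A invA (idA n)           ≡⟨ cong₂ _∘A_ (∘A-identityˡ _) ε⁻¹≈ε ⟩
    a g3 n ∘A idA n                             ≡⟨ ∘A-identityʳ _ ⟩
    a g3 n                                      ∎
  right : (a g1 n ∘A idA n) ∘A invA (a g1 n) ∘A a g3 n ≡ a g3 n
  right = begin
    (a g1 n ∘A idA n) ∘A invA (a g1 n) ∘A a g3 n  ≡⟨ cong (λ t → t ∘A invA (a g1 n) ∘A a g3 n) (∘A-identityʳ _) ⟩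
    a g1 n ∘A invA (a g1 n) ∘A a g3 n             ≡⟨ cong (_∘A a g3 n) (invA-inverseʳ _) ⟩
    idA n ∘A a g3 n                               ≡⟨ ∘A-identityˡ _ ⟩
    a g3 n                                        ∎
InG-diag one = one
InG-diag (mul p q) = mul (InG-diag p) (InG-diag q)
InG-diag (inv p) = inv (InG-diag p)

InG-extendˡ : ∀ {n g} → InG n g → Σ (Aut n) λ w → InG (suc n) (node false w g)
InG-extendˡ {n} (gen g1) = a g1 n , InG-diag (gen g1)
InG-extendˡ {n} (gen g2) = invA (a g1 n) ,
  subst (InG (suc n)) (cong₂ (node false) (∘A-identityʳ _) (trans (cong (_∘A a g2 n) ε⁻¹≈ε) (∘A-identityˡ _)))
    (mul (inv (gen g2)) (gen g3))
InG-extendˡ {n} (gen g3) = idA n , gen g1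
InG-extendˡ {n} one = idA n , one
InG-extendˡ (mul p q) = proj₁ (InG-extendˡ p) ∘A proj₁ (InG-extendˡ q) , mul (proj₂ (InG-extendˡ p)) (proj₂ (InG-extendˡ q))
InG-extendˡ (inv p) = invA (proj₁ (InG-extendˡ p)) , inv (proj₂ (InG-extendˡ p))

InG′-diag : ∀ {n x} → InG′ n x → InG′ (suc n) (diag x)
InG′-diag base = ⁅,⁆-∈G′ (InG-diag (gen g1)) (InG-diag (gen g2))
InG′-diag one = one
InG′-diag (mul p q) = mul (InG′-diag p) (InG′-diag q)
InG′-diag (inv p) = inv (InG′-diag p)
InG′-diag (conj g p) = conj (InG-diag g) (InG′-diag p)

InG′-embedʳ : ∀ {n x} → InG′ n x → InG′ (suc n) (embedʳ x)
InG′-embedʳ {n} base = subst (λ t → InG′ (suc n) (node false t ⁅ a g1 n , a g2 n ⁆)) (⁅x,x⁻¹⁆≡id (a g1 n))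
  (⁅,⁆-∈G′ (InG-diag (gen g1)) (proj₂ (InG-extendˡ (gen g2))))
InG′-embedʳ one = one
InG′-embedʳ {n} (mul {x} {y} p q) =
  subst (λ t → InG′ (suc n) (node false t (x ∘A y))) (∘A-identityˡ (idA n)) (mul (InG′-embedʳ p) (InG′-embedʳ q))
InG′-embedʳ {n} (inv {x} p) = subst (λ t → InG′ (suc n) (node false t (invA x))) ε⁻¹≈ε (inv (InG′-embedʳ p))
InG′-embedʳ {n} (conj {g} {x} g∈G p) =
  subst (λ t → InG′ (suc n) (node false t (g ∘A x ∘A invA g))) w∘w⁻¹≡id (conj (proj₂ (InG-extendˡ g∈G)) (InG′-embedʳ p))
  where
  w : Aut n
  w = proj₁ (InG-extendˡ g∈G)
  w∘w⁻¹≡id : w ∘A idA n ∘A invA w ≡ idA n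
  w∘w⁻¹≡id = trans (cong (_∘A invA w) (∘A-identityʳ w)) (invA-inverseʳ w)

powℕ-diag : ∀ {n} (x : Aut n) k → powℕ (diag x) k ≡ diag (powℕ x k)
powℕ-diag x zero = refl
powℕ-diag x (suc k) = cong (diag x ∘A_) (powℕ-diag x k)

powℕ-embedʳ : ∀ {n} (x : Aut n) k → powℕ (embedʳ x) k ≡ embedʳ (powℕ x k)
powℕ-embedʳ x zero = refl
powℕ-embedʳ {n} x (suc k) =
  trans (cong (embedʳ x ∘A_) (powℕ-embedʳ x k)) (cong (λ t → node false t (x ∘A powℕ x k)) (∘A-identityˡ (idA n)))

powℕ-a₂-even : ∀ n k → powℕ (a g2 (suc n)) (2 * k) ≡ diag (powℕ (a g1 n) k)
powℕ-a₂-even n k = begin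
  powℕ a₂ (2 * k)        ≡⟨ cong (powℕ a₂) (ℕ.*-comm 2 k) ⟩
  powℕ a₂ (k * 2)        ≡⟨ powℕ-* a₂ k 2 ⟩
  powℕ (powℕ a₂ 2) k     ≡⟨ cong (λ t → powℕ t k) a₂²≡diag-a₁ ⟩
  powℕ (diag (a g1 n)) k ≡⟨ powℕ-diag (a g1 n) k ⟩
  diag (powℕ (a g1 n) k) ∎
  where
  open ≡-Reasoning
  a₂ : Aut (suc n)
  a₂ = a g2 (suc n)
  a₂²≡diag-a₁ : powℕ a₂ 2 ≡ diag (a g1 n)
  a₂²≡diag-a₁ = trans (cong (a₂ ∘A_) (∘A-identityʳ a₂)) (cong₂ (node false) (∘A-identityˡ _) (∘A-identityʳ _))

a₂^M₁∈G′ : ∀ n → InG′ n (powℕ (a g2 n) (M₁ n))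
a₁^M₂∈G′ : ∀ n → InG′ n (powℕ (a g1 n) (M₂ n))

a₃^M₁∈G′ : ∀ n → InG′ n (powℕ (a g3 n) (M₁ n))
a₃^M₁∈G′ n = ≈id⇒∈ (≈-sym (begin
  idA n                                      ≡⟨ powℕ-id n M ⟨
  powℕ (idA n) M                             ≡⟨ cong (λ t → powℕ t M) (proj₁ (generator-relations n)) ⟨
  powℕ ((a₁ ∘A a₂) ∘A a₃) M                  ≈⟨ powℕ-∘-distrib (mul (gen g1) (gen g2)) (gen g3) M ⟩
  powℕ (a₁ ∘A a₂) M ∘A powℕ a₃ M             ≈⟨ ∘-congʳ (powℕ a₃ M) (powℕ-∘-distrib (gen g1) (gen g2) M) ⟩
  (powℕ a₁ M ∘A powℕ a₂ M) ∘A powℕ a₃ M      ≈⟨ ∘-congʳ (powℕ a₃ M) (∘-cong (InG-powℕ M (gen g1)) (∈⇒≈id a₁^M∈G′) (∈⇒≈id (a₂^M₁∈G′ n))) ⟩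
  (idA n ∘A idA n) ∘A powℕ a₃ M              ≡⟨ cong (_∘A powℕ a₃ M) (∘A-identityˡ (idA n)) ⟩
  idA n ∘A powℕ a₃ M                         ≡⟨ ∘A-identityˡ (powℕ a₃ M) ⟩
  powℕ a₃ M                                  ∎))
  where
  open NormalSubgroupProperties (InG′-isNormalSubgroup n)
  open ≈-Reasoning
  open Abelianisation n using (powℕ-∘-distrib)
  M : ℕ
  M = M₁ n
  a₁ a₂ a₃ : Aut n
  a₁ = a g1 n
  a₂ = a g2 n
  a₃ = a g3 n
  a₁^M∈G′ : InG′ n (powℕ a₁ M)
  a₁^M∈G′ = ∈-powℕ-∣ (M₂∣M₁ n) (gen g1) (a₁^M₂∈G′ n)

a₂^M₁∈G′ zero = one
a₂^M₁∈G′ (suc n) = subst (InG′ (suc n)) (sym (powℕ-a₂-even n (M₂ n))) (InG′-diag (a₁^M₂∈G′ n))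
a₁^M₂∈G′ zero = one
a₁^M₂∈G′ (suc n) = subst (InG′ (suc n)) (sym (powℕ-embedʳ (a g3 n) (M₁ n))) (InG′-embedʳ (a₃^M₁∈G′ n))

InN⊆InG : ∀ {n i x} → InN n i x → InG n x
InN⊆InG base = gen _
InN⊆InG one = one
InN⊆InG (mul p q) = mul (InN⊆InG p) (InN⊆InG q)
InN⊆InG (inv p) = inv (InN⊆InG p)
InN⊆InG (conj g p) = mul (mul g (InN⊆InG p)) (inv g)

-- c generates G_n/N_{i,n} with order exactly M: at most M since cᴹ ∈ N, at least M since
-- φ induces a homomorphism G_n/N_{i,n} → ℤ/M sending c to 1.
record CyclicQuotientWitness (n : ℕ) (i : Gen) (M : ℕ) : Set where
  open NormalSubgroupProperties (InN-isNormalSubgroup n i) using (_≈_)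
  field
    c          : Aut n
    c∈G        : InG n c
    cᴹ∈N       : InN n i (powℕ c M)
    exponent   : Gen → ℕ
    a≈powℕ     : ∀ j → a j n ≈ powℕ c (exponent j)
    φ          : Aut n → ℤ
    φ-id       : φ (idA n) ≡ 0ℤ
    φ-additive : Additive n M φ
    φ-aᵢ       : φ (a i n) ≡ 0ℤ [mod M ]
    φ-c        : φ c ≡ 1ℤ [mod M ]

module _ {n i M} .{{_ : NonZero M}} (W : CyclicQuotientWitness n i M) where
  open CyclicQuotientWitness W
  open NormalSubgroupProperties (InN-isNormalSubgroup n i)

  φ-vanishes : ∀ {x} → InN n i x → φ x ≡ 0ℤ [mod M ]
  φ-vanishes base = φ-aᵢ
  φ-vanishes one = mod-reflexive φ-id
  φ-vanishes (mul p q) = mod-trans (φ-additive (InN⊆InG p) (InN⊆InG q)) (mod-+-cong (φ-vanishes p) (φ-vanishes q))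
  φ-vanishes (inv p) = mod-trans (additive-inv φ-id φ-additive (InN⊆InG p)) (mod-neg-cong (φ-vanishes p))
  φ-vanishes (conj {g} {x} g∈G p) = begin
    φ (g ∘A x ∘A invA g)                ≈⟨ φ-additive (mul g∈G (InN⊆InG p)) (inv g∈G) ⟩
    φ (g ∘A x) + φ (invA g)             ≈⟨ mod-+-cong (φ-additive g∈G (InN⊆InG p)) (additive-inv φ-id φ-additive g∈G) ⟩
    (φ g + φ x) + - φ g                 ≈⟨ mod-+-congʳ (- φ g) (mod-+-congˡ (φ g) (φ-vanishes p)) ⟩
    (φ g + 0ℤ) + - φ g                  ≡⟨ cancel (φ g) ⟩
    0ℤ                                  ∎
    where
    open ModReasoning M
    cancel : ∀ a → (a + 0ℤ) + - a ≡ 0ℤ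
    cancel = solve-∀

  φ-powℕ : ∀ k → φ (powℕ c k) ≡ + k [mod M ]
  φ-powℕ zero = mod-reflexive φ-id
  φ-powℕ (suc k) = mod-trans (φ-additive c∈G (InG-powℕ k c∈G))
                     (mod-trans (mod-+-cong φ-c (φ-powℕ k)) (mod-reflexive (sym (ℤ.pos-+ 1 k))))

  InG⇒≈powℕ : ∀ {g} → InG n g → Σ ℕ λ k → g ≈ powℕ c k
  InG⇒≈powℕ (gen j) = exponent j , a≈powℕ j
  InG⇒≈powℕ one = 0 , ≈-refl
  InG⇒≈powℕ (mul {x} {y} p q) with InG⇒≈powℕ p | InG⇒≈powℕ q
  ... | k , x≈cᵏ | l , y≈cˡ =
    k ℕ.+ l , ≈-trans (∘-cong p x≈cᵏ y≈cˡ) (≈-reflexive (sym (powℕ-+ c k l)))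
  InG⇒≈powℕ (inv p) with InG⇒≈powℕ p
  ... | k , x≈cᵏ = pred M * k , ≈-trans (inv-cong p x≈cᵏ) (powℕ-inv M c∈G cᴹ∈N k)

  InG⇒≈powℕ-< : ∀ {g} → InG n g → Σ ℕ λ r → r < M × g ≈ powℕ c r
  InG⇒≈powℕ-< g∈G with InG⇒≈powℕ g∈G
  ... | k , g≈cᵏ = k % M , m%n<n k M , ≈-trans g≈cᵏ (powℕ-mod M c∈G cᴹ∈N k)

  powℕ-injective : ∀ {p q} → p < M → q < M → powℕ c p ≈ powℕ c q → p ≡ q
  powℕ-injective {p} {q} p<M q<M cᵖ≈cᑫ = mod-injective p<M q<M (begin
    + p                                              ≈⟨ φ-powℕ p ⟨
    φ cᵖ                                             ≡⟨ cong φ (cancel cᵖ cᑫ) ⟨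
    φ ((cᵖ ∘A invA cᑫ) ∘A cᑫ)                        ≈⟨ φ-additive (InN⊆InG cᵖ≈cᑫ) (InG-powℕ q c∈G) ⟩
    φ (cᵖ ∘A invA cᑫ) + φ cᑫ                         ≈⟨ mod-+-cong (φ-vanishes cᵖ≈cᑫ) (φ-powℕ q) ⟩
    0ℤ + + q                                         ≡⟨ ℤ.+-identityˡ (+ q) ⟩
    + q                                              ∎)
    where
    open ModReasoning M
    cᵖ cᑫ : Aut n
    cᵖ = powℕ c p
    cᑫ = powℕ c q
    cancel : ∀ x y → (x ∘A invA y) ∘A y ≡ x
    cancel x y = trans (∘A-assoc x (invA y) y) (trans (cong (x ∘A_) (invA-inverseˡ y)) (∘A-identityʳ x))

  witness⇒QuotOrder : QuotOrder n i M
  witness⇒QuotOrder = representatives , InG-representative , irredundant , complete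
    where
    representatives : Vec (Aut n) M
    representatives = tabulate (λ p → powℕ c (toℕ p))
    lookup-representative : ∀ p → lookup representatives p ≡ powℕ c (toℕ p)
    lookup-representative = lookup∘tabulate (λ p → powℕ c (toℕ p))
    InG-representative : ∀ p → InG n (lookup representatives p)
    InG-representative p = subst (InG n) (sym (lookup-representative p)) (InG-powℕ (toℕ p) c∈G)
    irredundant : ∀ p q → lookup representatives p ≈ lookup representatives q → p ≡ q
    irredundant p q r≈r′ = toℕ-injective (powℕ-injective (toℕ<n p) (toℕ<n q)
      (subst₂ _≈_ (lookup-representative p) (lookup-representative q) r≈r′))
    complete : ∀ g → InG n g → Σ (Fin M) λ p → g ≈ lookup representatives p
    complete g g∈G with InG⇒≈powℕ-< g∈G
    ... | r , r<M , g≈cʳ = fromℕ< r<M ,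
      subst (g ≈_) (sym (trans (lookup-representative (fromℕ< r<M)) (cong (powℕ c) (toℕ-fromℕ< r<M)))) g≈cʳ

  witness⇒QuotCyclic : QuotCyclic n i
  witness⇒QuotCyclic = c , c∈G , λ h h∈G → + proj₁ (InG⇒≈powℕ h∈G) , proj₂ (InG⇒≈powℕ h∈G)

index : Gen → ℕ → ℕ
index g1 = M₁
index g2 = M₂
index g3 = M₂

index-nonZero : ∀ i n → NonZero (index i n)
index-nonZero g1 n = ℕ.>-nonZero (M₁-positive n)
index-nonZero g2 n = ℕ.>-nonZero (M₂-positive n)
index-nonZero g3 n = ℕ.>-nonZero (M₂-positive n)

witness : ∀ n i → CyclicQuotientWitness n i (index i n)
witness n g1 = record
  { c = a g2 n ; c∈G = gen g2 ; cᴹ∈N = a₂ᴹ∈N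
  ; exponent = λ { g1 → 0 ; g2 → 1 ; g3 → pred (M₁ n) }
  ; a≈powℕ = λ { g1 → ∈⇒≈id base
               ; g2 → ≈-reflexive (sym (∘A-identityʳ _))
               ; g3 → ≈-trans (∈⇒≈inv a₃a₂∈N) (inv≈powℕ-pred (M₁ n) {{index-nonZero g1 n}} (gen g2) a₂ᴹ∈N) }
  ; φ = φ₁ ; φ-id = φ₁-identity n ; φ-additive = φ₁-additive n
  ; φ-aᵢ = φ₁-on-generators n g1 ; φ-c = φ₁-on-generators n g2
  }
  where
  open NormalSubgroupProperties (InN-isNormalSubgroup n g1)
  a₂ᴹ∈N : InN n g1 (powℕ (a g2 n) (M₁ n))
  a₂ᴹ∈N = InG′⊆InN g1 (a₂^M₁∈G′ n)
  a₃a₂∈N : InN n g1 (a g3 n ∘A a g2 n)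
  a₃a₂∈N = ∈-swap (gen g2) (InN-from-relation (proj₁ (proj₂ (generator-relations n))))
witness n g2 = record
  { c = a g1 n ; c∈G = gen g1 ; cᴹ∈N = a₁ᴹ∈N
  ; exponent = λ { g1 → 1 ; g2 → 0 ; g3 → pred (M₂ n) }
  ; a≈powℕ = λ { g1 → ≈-reflexive (sym (∘A-identityʳ _))
               ; g2 → ∈⇒≈id base
               ; g3 → ≈-trans (∈⇒≈inv a₃a₁∈N) (inv≈powℕ-pred (M₂ n) {{index-nonZero g2 n}} (gen g1) a₁ᴹ∈N) }
  ; φ = φ₂ ; φ-id = φ₂-identity n ; φ-additive = φ₂-additive n
  ; φ-aᵢ = φ₂-on-generators n g2 ; φ-c = φ₂-on-generators n g1
  }
  where
  open NormalSubgroupProperties (InN-isNormalSubgroup n g2)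
  a₁ᴹ∈N : InN n g2 (powℕ (a g1 n) (M₂ n))
  a₁ᴹ∈N = InG′⊆InN g2 (a₁^M₂∈G′ n)
  a₃a₁∈N : InN n g2 (a g3 n ∘A a g1 n)
  a₃a₁∈N = InN-from-relation (proj₂ (proj₂ (generator-relations n)))
witness n g3 = record
  { c = a g1 n ; c∈G = gen g1 ; cᴹ∈N = a₁ᴹ∈N
  ; exponent = λ { g1 → 1 ; g2 → pred (M₂ n) ; g3 → 0 }
  ; a≈powℕ = λ { g1 → ≈-reflexive (sym (∘A-identityʳ _))
               ; g2 → ≈-trans (∈⇒≈inv a₂a₁∈N) (inv≈powℕ-pred (M₂ n) {{index-nonZero g3 n}} (gen g1) a₁ᴹ∈N)
               ; g3 → ∈⇒≈id base }
  ; φ = φ₃ ; φ-id = φ₃-identity n ; φ-additive = φ₃-additive n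
  ; φ-aᵢ = φ₃-on-generators n g3 ; φ-c = φ₃-on-generators n g1
  }
  where
  open NormalSubgroupProperties (InN-isNormalSubgroup n g3)
  a₁ᴹ∈N : InN n g3 (powℕ (a g1 n) (M₂ n))
  a₁ᴹ∈N = InG′⊆InN g3 (a₁^M₂∈G′ n)
  a₂a₁∈N : InN n g3 (a g2 n ∘A a g1 n)
  a₂a₁∈N = ∈-swap (gen g1) (InN-from-relation (proj₁ (generator-relations n)))

quotient-order : ∀ n i → QuotOrder n i (index i n)
quotient-order n i = witness⇒QuotOrder {{index-nonZero i n}} (witness n i)

quotient-cyclic : ∀ n i → QuotCyclic n i
quotient-cyclic n i = witness⇒QuotCyclic {{index-nonZero i n}} (witness n i)

proposition7p10 : (n : ℕ) → 2 ≤ n →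
      ((i : Gen) → QuotCyclic n i ×
        (Σ ℕ λ m → Σ ℕ λ m' → QuotOrder n i m × QuotOrder (n ∸ 1) i m' × m ≤ 2 * m'))
    × (Σ ℕ λ m → Σ ℕ λ m' → QuotOrder n g3 m × QuotOrder (n ∸ 1) g2 m' × m' ≤ m)
    × (Σ ℕ λ m → Σ ℕ λ m' → QuotOrder n g2 m × QuotOrder (n ∸ 1) g1 m' × m' ≤ m)
    × (Σ ℕ λ m → Σ ℕ λ m' → QuotOrder n g1 m × QuotOrder (n ∸ 1) g3 m' × 2 * m' ≤ m)
proposition7p10 zero ()
proposition7p10 (suc n) _ =
    (λ i → quotient-cyclic (suc n) i , orders i i (index-doubling i))
  , orders g3 g2 (M₂≤M₁ n)
  , orders g2 g1 ℕ.≤-refl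
  , orders g1 g3 ℕ.≤-refl
  where
  orders : ∀ i j {R : ℕ → ℕ → Set} → R (index i (suc n)) (index j n) →
           Σ ℕ λ m → Σ ℕ λ m' → QuotOrder (suc n) i m × QuotOrder n j m' × R m m'
  orders i j r = index i (suc n) , index j n , quotient-order (suc n) i , quotient-order n j , r
  index-doubling : ∀ i → index i (suc n) ≤ 2 * index i n
  index-doubling g1 = ℕ.*-monoʳ-≤ 2 (M₂≤M₁ n)
  index-doubling g2 = M₁≤2*M₂ n
  index-doubling g3 = M₁≤2*M₂ n
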